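{- Let $n$ be a positive integer, let $\lambda=(\lambda_1\ge\cdots\ge\lambda_n)$ be a partition with exactly $n$ parts, $\lambda_1=n$, and $\lambda_i\ge n+1-i$ for all $i$. Let $\pi$ be uniformly distributed on $\operatorname{RP}(\lambda)$, and let $i,j\in[n]$. (a) If $\lambda_{n+1-i}<j$, then $\mathbb{E}(\pi_{ij})=0$. (b) If $\lambda_{n+1-i}\ge j$, and $i'\in[n]$ is the smallest index with $\lambda_{n+1-i'}\ge j$, then \[ \mathbb{E}(\pi_{ij}) = \left( \prod_{i' \le t < i} \frac{\lambda_{n+1-t} - t}{\lambda_{n+1-t} - t + 1} \right) \cdot \frac{1}{\lambda_{n+1-i} - i + 1}. \]
   Context: For such $\lambda$, $\operatorname{RP}(\lambda)$ is the (nonempty) set of $n\times n$ permutation matrices $\pi=(\pi_{ij})$ such that $\pi_{ij}=0$ whenever $j>\lambda_{n+1-i}$. -}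

module Defs where

open import Data.Nat as ℕ using (ℕ; zero; suc; _≤_; _<_; _∸_)
open import Data.Nat.Properties using (_≤?_; _<?_)
open import Data.Fin as Fin using (Fin; toℕ; opposite)
open import Data.Fin.Properties using (all?) renaming (_≟_ to _≟ᶠ_)
open import Data.Vec using (Vec; []; _∷_; lookup)
open import Data.List using (List; []; _∷_; map; concatMap; filter; length; allFin; foldr)
open import Data.Integer using (+_)
open import Data.Rational using (ℚ; _/_; _*_; 0ℚ; 1ℚ)
open import Data.Product using (_×_)
open import Relation.Nullary.Decidable using (Dec; _→-dec_; _×-dec_)
open import Relation.Binary.PropositionalEquality using (_≡_)

-- Conventions: indices i, j ∈ [n] are represented 0-based by Fin n
-- (the 1-based index is toℕ i + 1).  A partition with n parts is
-- λ : Fin n → ℕ, with λ k = λ_{toℕ k + 1}.  Hence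
-- λ_{n+1-i} (for 1-based i = toℕ i + 1) is λ (opposite i).

IsPartition : (n : ℕ) → (Fin n → ℕ) → Set
IsPartition n lam =
  (∀ (a b : Fin n) → toℕ a ≤ toℕ b → lam b ≤ lam a) × (∀ (a : Fin n) → 1 ≤ lam a)

-- A permutation matrix π is encoded by the vector v with
-- π_{r c} = 1  iff  lookup v r ≡ c  (v injective).
IsPermVec : (n : ℕ) → Vec (Fin n) n → Set
IsPermVec n v = ∀ (r s : Fin n) → lookup v r ≡ lookup v s → r ≡ s

isPermVec? : (n : ℕ) → (v : Vec (Fin n) n) → Dec (IsPermVec n v)
isPermVec? n v = all? λ r → all? λ s → (lookup v r ≟ᶠ lookup v s) →-dec (r ≟ᶠ s)

-- π ∈ RP(λ): π_{r c} = 0 whenever c > λ_{n+1-r} (1-based), i.e. the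
-- 1-based column of the unique 1 in row r is at most λ_{n+1-r}.
InRP : (n : ℕ) → (Fin n → ℕ) → Vec (Fin n) n → Set
InRP n lam v = IsPermVec n v × (∀ (r : Fin n) → suc (toℕ (lookup v r)) ≤ lam (opposite r))

inRP? : (n : ℕ) → (lam : Fin n → ℕ) → (v : Vec (Fin n) n) → Dec (InRP n lam v)
inRP? n lam v = isPermVec? n v ×-dec all? (λ r → suc (toℕ (lookup v r)) ≤? lam (opposite r))

allVecs : (n k : ℕ) → List (Vec (Fin n) k)
allVecs n zero = [] ∷ []
allVecs n (suc k) = concatMap (λ x → map (x ∷_) (allVecs n k)) (allFin n)

RP : (n : ℕ) → (Fin n → ℕ) → List (Vec (Fin n) n)
RP n lam = filter (inRP? n lam) (allVecs n n)

-- Expectation of π_{ij} for π uniform on RP(λ):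
-- (#{π ∈ RP(λ) : π_{ij} = 1}) / #RP(λ)   (defined as 0 if RP(λ) were empty).
ratio : ℕ → ℕ → ℚ
ratio a zero = 0ℚ
ratio a (suc b) = (+ a) / suc b

expectEntry : (n : ℕ) → (Fin n → ℕ) → Fin n → Fin n → ℚ
expectEntry n lam i j =
  ratio (length (filter (λ v → lookup v i ≟ᶠ j) (RP n lam))) (length (RP n lam))

-- Product over 1-based t with i' ≤ t < i of
--   (λ_{n+1-t} - t) / (λ_{n+1-t} - t + 1),
-- where i', i are given 0-based (so the 1-based t is toℕ t + 1).
factor : (n : ℕ) → (Fin n → ℕ) → Fin n → ℚ
factor n lam t = (+ (lam (opposite t) ∸ suc (toℕ t))) / suc (lam (opposite t) ∸ suc (toℕ t))

prodFactors : (n : ℕ) → (Fin n → ℕ) → Fin n → Fin n → ℚ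
prodFactors n lam i' i =
  foldr (λ t acc → factor n lam t * acc) 1ℚ
    (filter (λ t → (toℕ i' ≤? toℕ t) ×-dec (toℕ t <? toℕ i)) (allFin n))

lastFactor : (n : ℕ) → (Fin n → ℕ) → Fin n → ℚ
lastFactor n lam i = (+ 1) / suc (lam (opposite i) ∸ suc (toℕ i))

{-# OPTIONS --safe #-}
module Submission where

-- Let B r = λ_{n-r} be the number of columns open to row r (0-based); B is weakly increasing
-- and r < B r.  Fill the rows in the order 0, 1, …, n-1: the r rows already filled occupy r
-- columns, all below B r, so row r always has exactly B r - r free columns and
-- #RP(λ) = ∏_r (B r - r).  Count the π with π_ij = 1 in the same way, keeping the rows above i
-- off column j: such a row r loses one choice exactly when j < B r, i.e. when i' ≤ r, and row i
-- has the single choice j.  Dividing the two products row by row leaves the factor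
-- (B r - r - 1)/(B r - r) for i' ≤ r < i and 1/(B i - i) for row i.

open import Defs
open import Data.Nat using (ℕ; suc; _≤_; _<_; _≥_; _∸_; NonZero)
open import Data.Fin using (Fin; toℕ; opposite; zero)
open import Data.Rational using (ℚ; _*_; 0ℚ)
open import Data.Product using (_×_)
open import Relation.Binary.PropositionalEquality using (_≡_)

open import Level using (0ℓ)
open import Function using (_∘_)
open import Function.Definitions using (Injective)
open import Data.Bool using (if_then_else_)
open import Data.Empty using (⊥-elim)
open import Data.Unit using (⊤; tt)
open import Data.Product using (_,_; proj₁; proj₂)
open import Data.Nat as ℕ using (zero; _+_; z≤n; s≤s; _<?_; _≤?_)
import Data.Nat.Properties as ℕP
open import Data.Nat.ListAction using (sum)
open import Data.Fin as Fin using (suc)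
open import Data.Fin.Properties using (suc-injective; toℕ-injective; opposite-prop; toℕ-fromℕ<; toℕ<n)
  renaming (_≟_ to _≟ᶠ_)
open import Data.Vec using (Vec; []; _∷_; lookup)
open import Data.List using (List; []; _∷_; map; filter; length; concatMap; allFin; _++_; foldr)
open import Data.List.Properties using (map-tabulate; foldr-map; length-++; filter-++; filter-≐; filter-all; filter-none)
open import Data.List.Relation.Unary.All as All using (All; []; _∷_)
open import Data.List.Relation.Unary.All.Properties using (¬Any⇒All¬; All¬⇒¬Any)
open import Data.List.Relation.Unary.Any using (here; there)
open import Data.List.Relation.Unary.Unique.Propositional using (Unique)
open import Data.List.Relation.Unary.AllPairs using ([]; _∷_)
open import Data.List.Membership.Propositional using (_∉_)
import Data.Integer as ℤ
import Data.Integer.Properties as ℤP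
open import Data.Rational using (1ℚ; fromℚᵘ; toℚᵘ)
import Data.Rational.Properties as ℚP
import Data.Rational.Unnormalised as ℚᵘ
import Data.Rational.Unnormalised.Properties as ℚᵘP
open import Relation.Nullary using (Dec; yes; no; ¬_; does)
open import Relation.Nullary.Decidable using (_×-dec_; _→-dec_; ¬?; dec-true; dec-false)
open import Relation.Binary.Definitions using (tri<; tri≈; tri>)
open import Relation.Unary using (Pred; Decidable; _≐_; _∩_; ∁)
open import Relation.Unary.Properties using (_∩?_; ∁?)
open import Relation.Binary.PropositionalEquality using (_≢_; refl; sym; trans; cong; cong₂; subst; subst₂; module ≡-Reasoning)
open import Algebra.Properties.Monoid.Sum ℕP.*-1-monoid using ()
  renaming (sum to ∏ℕ; sum-cong-≗ to ∏ℕ-cong)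
open import Algebra.Properties.CommutativeMonoid.Sum ℚP.*-1-commutativeMonoid using ()
  renaming (sum to ∏ℚ; sum-cong-≗ to ∏ℚ-cong; ∑-distrib-+ to ∏ℚ-distrib-*; sum-replicate-zero to ∏ℚ-ones)

module _ {A : Set} {P : Pred A 0ℓ} (P? : Decidable P) where

  length-filter-≐ : ∀ {Q : Pred A 0ℓ} (Q? : Decidable Q) → P ≐ Q →
                    ∀ xs → length (filter P? xs) ≡ length (filter Q? xs)
  length-filter-≐ Q? P≐Q xs = cong length (filter-≐ P? Q? P≐Q xs)

  length-filter-all : ∀ {xs} → All P xs → length (filter P? xs) ≡ length xs
  length-filter-all Pxs = cong length (filter-all P? Pxs)

  length-filter-none : ∀ {xs} → All (∁ P) xs → length (filter P? xs) ≡ 0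
  length-filter-none ¬Pxs = cong length (filter-none P? ¬Pxs)

  length-filter-++ : ∀ xs ys → length (filter P? (xs ++ ys)) ≡ length (filter P? xs) + length (filter P? ys)
  length-filter-++ xs ys = trans (cong length (filter-++ P? xs ys)) (length-++ (filter P? xs))

  length-filter-filter : ∀ {Q : Pred A 0ℓ} (Q? : Decidable Q) xs →
                         length (filter P? (filter Q? xs)) ≡ length (filter (Q? ∩? P?) xs)
  length-filter-filter Q? [] = refl
  length-filter-filter Q? (x ∷ xs) with Q? x
  ... | no _ = length-filter-filter Q? xs
  ... | yes _ with P? x
  ...   | yes _ = cong suc (length-filter-filter Q? xs)
  ...   | no _  = length-filter-filter Q? xs

  length-filter-partition : ∀ {R : Pred A 0ℓ} (R? : Decidable R) xs →
    length (filter P? xs) ≡ length (filter (P? ∩? R?) xs) + length (filter (P? ∩? ∁? R?) xs)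
  length-filter-partition R? [] = refl
  length-filter-partition R? (x ∷ xs) with P? x
  ... | no _ = length-filter-partition R? xs
  ... | yes _ with R? x
  ...   | yes _ = cong suc (length-filter-partition R? xs)
  ...   | no _  = trans (cong suc (length-filter-partition R? xs)) (sym (ℕP.+-suc _ _))

  length-filter-map : ∀ {B : Set} (f : B → A) xs → length (filter P? (map f xs)) ≡ length (filter (P? ∘ f) xs)
  length-filter-map f [] = refl
  length-filter-map f (x ∷ xs) with P? (f x)
  ... | yes _ = cong suc (length-filter-map f xs)
  ... | no _  = length-filter-map f xs

  length-filter-concatMap : ∀ {B : Set} (f : B → List A) xs →
    length (filter P? (concatMap f xs)) ≡ sum (map (λ x → length (filter P? (f x))) xs)
  length-filter-concatMap f [] = refl
  length-filter-concatMap f (x ∷ xs) =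
    trans (length-filter-++ (f x) (concatMap f xs)) (cong (length (filter P? (f x)) +_) (length-filter-concatMap f xs))

  sum-map-indicator : ∀ (g : A → ℕ) (c : ℕ) → (∀ x → P x → g x ≡ c) → (∀ x → ¬ P x → g x ≡ 0) →
                      ∀ xs → sum (map g xs) ≡ length (filter P? xs) ℕ.* c
  sum-map-indicator g c gP g¬P [] = refl
  sum-map-indicator g c gP g¬P (x ∷ xs) with P? x
  ... | yes p = cong₂ _+_ (gP x p) (sum-map-indicator g c gP g¬P xs)
  ... | no ¬p = cong₂ _+_ (g¬P x ¬p) (sum-map-indicator g c gP g¬P xs)

allFin-suc : ∀ n → allFin (suc n) ≡ zero ∷ map suc (allFin n)
allFin-suc n = cong (zero ∷_) (sym (map-tabulate (λ x → x) suc))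

length-filter-allFin-suc : ∀ {n} {P : Pred (Fin (suc n)) 0ℓ} (P? : Decidable P) →
  length (filter P? (allFin (suc n))) ≡ length (filter P? (zero ∷ [])) + length (filter (P? ∘ suc) (allFin n))
length-filter-allFin-suc {n} P? = begin
    length (filter P? (allFin (suc n)))
  ≡⟨ cong (length ∘ filter P?) (allFin-suc n) ⟩
    length (filter P? (zero ∷ map suc (allFin n)))
  ≡⟨ length-filter-++ P? (zero ∷ []) (map suc (allFin n)) ⟩
    length (filter P? (zero ∷ [])) + length (filter P? (map suc (allFin n)))
  ≡⟨ cong (length (filter P? (zero ∷ [])) +_) (length-filter-map P? suc (allFin n)) ⟩
    length (filter P? (zero ∷ [])) + length (filter (P? ∘ suc) (allFin n)) ∎
  where open ≡-Reasoning

count-≡ : ∀ n (a : Fin n) → length (filter (_≟ᶠ a) (allFin n)) ≡ 1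
count-≡ (suc n) a = trans (length-filter-allFin-suc (_≟ᶠ a)) (tail a)
  where
  tail : ∀ a → length (filter (_≟ᶠ a) (zero ∷ [])) + length (filter ((_≟ᶠ a) ∘ suc) (allFin n)) ≡ 1
  tail zero    = cong suc (length-filter-none _ (All.universal (λ _ ()) (allFin n)))
  tail (suc a) = trans (length-filter-≐ _ (_≟ᶠ a) (suc-injective , cong suc) (allFin n)) (count-≡ n a)

below? : ∀ {n} (b : ℕ) → Decidable (λ (c : Fin n) → toℕ c < b)
below? b c = toℕ c <? b

count-below : ∀ {n b} → b ≤ n → length (filter (below? b) (allFin n)) ≡ b
count-below {zero}  z≤n = refl
count-below {suc n} {b} b≤n = trans (length-filter-allFin-suc (below? b)) (tail b≤n)
  where
  tail : ∀ {b} → b ≤ suc n → length (filter (below? b) (zero ∷ [])) + length (filter (below? b ∘ suc) (allFin n)) ≡ b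
  tail {zero}  _         = length-filter-none _ (All.universal (λ _ ()) (allFin n))
  tail {suc b} (s≤s b≤n) = cong suc (trans (length-filter-≐ _ (below? b) (ℕ.s≤s⁻¹ , s≤s) (allFin n)) (count-below b≤n))

count-below-≢ : ∀ {n b} (j : Fin n) → toℕ j < b → b ≤ n →
                length (filter (below? b ∩? ∁? (_≟ᶠ j)) (allFin n)) ≡ b ∸ 1
count-below-≢ {n} {b} j j<b b≤n = begin
    X
  ≡⟨ ℕP.m+n∸m≡n 1 X ⟨
    1 + X ∸ 1
  ≡⟨ cong (λ k → k + X ∸ 1) only-j ⟨
    length (filter (below? b ∩? (_≟ᶠ j)) (allFin n)) + X ∸ 1
  ≡⟨ cong (_∸ 1) (length-filter-partition (below? b) (_≟ᶠ j) (allFin n)) ⟨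
    length (filter (below? b) (allFin n)) ∸ 1
  ≡⟨ cong (_∸ 1) (count-below b≤n) ⟩
    b ∸ 1 ∎
  where
  open ≡-Reasoning
  X = length (filter (below? b ∩? ∁? (_≟ᶠ j)) (allFin n))
  only-j : length (filter (below? b ∩? (_≟ᶠ j)) (allFin n)) ≡ 1
  only-j = trans (length-filter-≐ _ (_≟ᶠ j) (proj₂ , λ { refl → j<b , refl }) (allFin n)) (count-≡ n j)

module _ {n : ℕ} {Q : Pred (Fin n) 0ℓ} (Q? : Decidable Q) where
  open import Data.List.Membership.DecPropositional (_≟ᶠ_ {n}) using (_∈?_)

  count-∉ : ∀ {L} → Unique L →
            length (filter (Q? ∩? ∁? (_∈? L)) (allFin n)) + length (filter Q? L) ≡ length (filter Q? (allFin n))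
  count-∉ {[]} [] = trans (ℕP.+-identityʳ _) (length-filter-≐ _ Q? (proj₁ , (_, λ ())) (allFin n))
  count-∉ {a ∷ L} (a≢L ∷ uL) = begin
      X (a ∷ L) + length (filter Q? (a ∷ L))
    ≡⟨ cong (X (a ∷ L) +_) (length-filter-++ Q? (a ∷ []) L) ⟩
      X (a ∷ L) + (qa + length (filter Q? L))
    ≡⟨ sym (ℕP.+-assoc (X (a ∷ L)) qa _) ⟩
      (X (a ∷ L) + qa) + length (filter Q? L)
    ≡⟨ cong (_+ length (filter Q? L)) (trans (ℕP.+-comm (X (a ∷ L)) qa) (sym X[L])) ⟩
      X L + length (filter Q? L)
    ≡⟨ count-∉ uL ⟩
      length (filter Q? (allFin n)) ∎
    where
    open ≡-Reasoning
    X : List (Fin n) → ℕ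
    X L = length (filter (Q? ∩? ∁? (_∈? L)) (allFin n))
    qa = length (filter Q? (a ∷ []))
    a∉L : a ∉ L
    a∉L = All¬⇒¬Any a≢L
    X[L]∩a : length (filter ((Q? ∩? ∁? (_∈? L)) ∩? (_≟ᶠ a)) (allFin n)) ≡ qa
    X[L]∩a with Q? a
    ... | yes Qa = trans (length-filter-≐ _ (_≟ᶠ a) (proj₂ , λ { refl → (Qa , a∉L) , refl }) (allFin n)) (count-≡ n a)
    ... | no ¬Qa = length-filter-none _ (All.universal (λ { _ ((Qa , _) , refl) → ¬Qa Qa }) (allFin n))
    X[L]∖a : length (filter ((Q? ∩? ∁? (_∈? L)) ∩? ∁? (_≟ᶠ a)) (allFin n)) ≡ X (a ∷ L)
    X[L]∖a = length-filter-≐ _ _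
      ( (λ { ((q , c∉L) , c≢a) → q , λ { (here c≡a) → c≢a c≡a ; (there c∈L) → c∉L c∈L } })
      , (λ { (q , c∉aL) → (q , c∉aL ∘ there) , c∉aL ∘ here }) ) (allFin n)
    X[L] : X L ≡ qa + X (a ∷ L)
    X[L] = trans (length-filter-partition _ (_≟ᶠ a) (allFin n)) (cong₂ _+_ X[L]∩a X[L]∖a)

ratio-0 : ∀ b → ratio 0 b ≡ 0ℚ
ratio-0 zero    = refl
ratio-0 (suc b) = ℚP.0/n≡0 (suc b)

ratio-n/n : ∀ b → ratio (suc b) (suc b) ≡ 1ℚ
ratio-n/n b = ℚP.fromℚᵘ-cong {ℚᵘ.mkℚᵘ (ℤ.+ suc b) b} {ℚᵘ.1ℚᵘ}
  (ℚᵘ.*≡* (trans (ℤP.*-identityʳ (ℤ.+ suc b)) (sym (ℤP.*-identityˡ (ℤ.+ suc b)))))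

ratio-* : ∀ a c {b d} → 0 < b → 0 < d → ratio (a ℕ.* c) (b ℕ.* d) ≡ ratio a b * ratio c d
ratio-* a c {suc b} {suc d} _ _ = begin
  ratio (a ℕ.* c) (suc b ℕ.* suc d)   ≡⟨ ℚP./-cong (ℤP.pos-* a c) refl ⟩
  fromℚᵘ (p ℚᵘ.* q)                 ≡⟨ ℚP.fromℚᵘ-cong p*q≃ ⟨
  fromℚᵘ (toℚᵘ (fromℚᵘ p * fromℚᵘ q)) ≡⟨ ℚP.fromℚᵘ-toℚᵘ _ ⟩
  fromℚᵘ p * fromℚᵘ q               ∎
  where
  open ≡-Reasoning
  p = ℚᵘ.mkℚᵘ (ℤ.+ a) b
  q = ℚᵘ.mkℚᵘ (ℤ.+ c) d
  p*q≃ : toℚᵘ (fromℚᵘ p * fromℚᵘ q) ℚᵘ.≃ (p ℚᵘ.* q)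
  p*q≃ = ℚᵘP.≃-trans (ℚP.toℚᵘ-homo-* (fromℚᵘ p) (fromℚᵘ q))
                     (ℚᵘP.*-cong (ℚP.toℚᵘ-fromℚᵘ p) (ℚP.toℚᵘ-fromℚᵘ q))

∏ℕ-pos : ∀ {k} (d : Fin k → ℕ) → (∀ t → 0 < d t) → 0 < ∏ℕ d
∏ℕ-pos {zero}  d pos = s≤s z≤n
∏ℕ-pos {suc k} d pos = ℕP.*-mono-≤ (pos zero) (∏ℕ-pos (d ∘ suc) (pos ∘ suc))

ratio-∏ : ∀ {k} (a d : Fin k → ℕ) → (∀ t → 0 < d t) → ratio (∏ℕ a) (∏ℕ d) ≡ ∏ℚ (λ t → ratio (a t) (d t))
ratio-∏ {zero}  a d pos = refl
ratio-∏ {suc k} a d pos = trans (ratio-* (a zero) (∏ℕ (a ∘ suc)) (pos zero) (∏ℕ-pos (d ∘ suc) (pos ∘ suc)))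
                                (cong (ratio (a zero) (d zero) *_) (ratio-∏ (a ∘ suc) (d ∘ suc) (pos ∘ suc)))

∏ℚ-single : ∀ {k} (f : Fin k → ℚ) a → (∀ t → t ≢ a → f t ≡ 1ℚ) → ∏ℚ f ≡ f a
∏ℚ-single {suc k} f zero f≡1 = begin
  f zero * ∏ℚ (f ∘ suc)          ≡⟨ cong (f zero *_) (∏ℚ-cong (λ t → f≡1 (suc t) λ ())) ⟩
  f zero * ∏ℚ {k} (λ _ → 1ℚ)     ≡⟨ cong (f zero *_) (∏ℚ-ones k) ⟩
  f zero * 1ℚ                    ≡⟨ ℚP.*-identityʳ (f zero) ⟩
  f zero                         ∎
  where open ≡-Reasoning
∏ℚ-single {suc k} f (suc a) f≡1 = begin
  f zero * ∏ℚ (f ∘ suc)          ≡⟨ cong₂ _*_ (f≡1 zero λ ()) (∏ℚ-single (f ∘ suc) a f∘suc≡1) ⟩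
  1ℚ * f (suc a)                 ≡⟨ ℚP.*-identityˡ (f (suc a)) ⟩
  f (suc a)                      ∎
  where
  open ≡-Reasoning
  f∘suc≡1 : ∀ t → t ≢ a → f (suc t) ≡ 1ℚ
  f∘suc≡1 t t≢a = f≡1 (suc t) (t≢a ∘ suc-injective)

foldr-*-filter : ∀ {A : Set} {R : Pred A 0ℓ} (R? : Decidable R) (f : A → ℚ) xs →
  foldr (λ t acc → f t * acc) 1ℚ (filter R? xs) ≡ foldr (λ t acc → (if does (R? t) then f t else 1ℚ) * acc) 1ℚ xs
foldr-*-filter R? f [] = refl
foldr-*-filter R? f (x ∷ xs) with R? x
... | yes _ = cong (f x *_) (foldr-*-filter R? f xs)
... | no _  = trans (foldr-*-filter R? f xs) (sym (ℚP.*-identityˡ _))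

foldr-*-allFin : ∀ {k} (f : Fin k → ℚ) → foldr (λ t acc → f t * acc) 1ℚ (allFin k) ≡ ∏ℚ f
foldr-*-allFin {zero}  f = refl
foldr-*-allFin {suc k} f = begin
  foldr (λ t acc → f t * acc) 1ℚ (allFin (suc k))           ≡⟨ cong (foldr (λ t acc → f t * acc) 1ℚ) (allFin-suc k) ⟩
  f zero * foldr (λ t acc → f t * acc) 1ℚ (map suc (allFin k)) ≡⟨ cong (f zero *_) (foldr-map _ suc 1ℚ (allFin k)) ⟩
  f zero * foldr (λ t acc → f (suc t) * acc) 1ℚ (allFin k)     ≡⟨ cong (f zero *_) (foldr-*-allFin (f ∘ suc)) ⟩
  f zero * ∏ℚ (f ∘ suc)                                       ∎
  where open ≡-Reasoning

module Sequences {n : ℕ} (A : ℕ → Pred (Fin n) 0ℓ) (A? : ∀ s → Decidable (A s)) where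
  open import Data.List.Membership.DecPropositional (_≟ᶠ_ {n}) using (_∈?_)

  Free : ℕ → List (Fin n) → Pred (Fin n) 0ℓ
  Free s used = A s ∩ (_∉ used)

  free? : ∀ s used → Decidable (Free s used)
  free? s used = A? s ∩? ∁? (_∈? used)

  #free : ℕ → List (Fin n) → ℕ
  #free s used = length (filter (free? s used) (allFin n))

  #allowed : ℕ → ℕ
  #allowed s = length (filter (A? s) (allFin n))

  Admissible : ℕ → List (Fin n) → ∀ {k} → Vec (Fin n) k → Set
  Admissible s used []      = ⊤
  Admissible s used (x ∷ v) = Free s used x × Admissible (suc s) (x ∷ used) v

  admissible? : ∀ s used {k} (v : Vec (Fin n) k) → Dec (Admissible s used v)
  admissible? s used []      = yes tt
  admissible? s used (x ∷ v) = free? s used x ×-dec admissible? (suc s) (x ∷ used) v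

  -- used lists the columns chosen for rows s-1, …, 0, latest first.
  data Prefix : ℕ → List (Fin n) → Set where
    []  : Prefix 0 []
    _∷_ : ∀ {s used x} → Free s used x → Prefix s used → Prefix (suc s) (x ∷ used)

  prefix-length : ∀ {s used} → Prefix s used → length used ≡ s
  prefix-length []      = refl
  prefix-length (_ ∷ p) = cong suc (prefix-length p)

  prefix-unique : ∀ {s used} → Prefix s used → Unique used
  prefix-unique []                   = []
  prefix-unique {used = _ ∷ used} ((_ , x∉used) ∷ p) = ¬Any⇒All¬ used x∉used ∷ prefix-unique p

  prefix-All : ∀ {Q : Pred (Fin n) 0ℓ} {s used} → Prefix s used → (∀ {r c} → r < s → A r c → Q c) → All Q used
  prefix-All []             A⇒Q = []
  prefix-All ((Ax , _) ∷ p) A⇒Q = A⇒Q ℕP.≤-refl Ax ∷ prefix-All p (A⇒Q ∘ ℕP.m≤n⇒m≤1+n)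

  #free-⊆ : ∀ {s used} → Prefix s used → All (A s) used → #free s used ≡ #allowed s ∸ s
  #free-⊆ {s} {used} p used⊆A = begin
    #free s used                                    ≡⟨ ℕP.m+n∸n≡m (#free s used) s ⟨
    #free s used + s ∸ s                            ≡⟨ cong (λ k → #free s used + k ∸ s) #used ⟨
    #free s used + length (filter (A? s) used) ∸ s  ≡⟨ cong (_∸ s) (count-∉ (A? s) (prefix-unique p)) ⟩
    #allowed s ∸ s                                  ∎
    where
    open ≡-Reasoning
    #used : length (filter (A? s) used) ≡ s
    #used = trans (length-filter-all (A? s) used⊆A) (prefix-length p)

  #free-disjoint : ∀ {s used} → Prefix s used → All (∁ (A s)) used → #free s used ≡ #allowed s
  #free-disjoint {s} {used} p used∩A≡∅ = begin
    #free s used                                    ≡⟨ ℕP.+-identityʳ (#free s used) ⟨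
    #free s used + 0                                ≡⟨ cong (#free s used +_) (length-filter-none (A? s) used∩A≡∅) ⟨
    #free s used + length (filter (A? s) used)      ≡⟨ count-∉ (A? s) (prefix-unique p) ⟩
    #allowed s                                      ∎
    where open ≡-Reasoning

  module _ (m : ℕ → ℕ) (#free≡m : ∀ {s used} → Prefix s used → #free s used ≡ m s) where

    count-admissible : ∀ k {s used} → Prefix s used →
      length (filter (admissible? s used) (allVecs n k)) ≡ ∏ℕ (λ (t : Fin k) → m (s + toℕ t))
    count-admissible zero    _ = refl
    count-admissible (suc k) {s} {used} p = begin
        length (filter (admissible? s used) (allVecs n (suc k)))
      ≡⟨ length-filter-concatMap (admissible? s used) (λ x → map (x ∷_) (allVecs n k)) (allFin n) ⟩
        sum (map extensions (allFin n))
      ≡⟨ sum-map-indicator (free? s used) extensions rest extensions-free extensions-blocked (allFin n) ⟩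
        #free s used ℕ.* rest
      ≡⟨ cong₂ ℕ._*_ (trans (#free≡m p) (cong m (sym (ℕP.+-identityʳ s))))
                     (∏ℕ-cong {k} (λ t → cong m (sym (ℕP.+-suc s (toℕ t))))) ⟩
        ∏ℕ (λ (t : Fin (suc k)) → m (s + toℕ t)) ∎
      where
      open ≡-Reasoning
      extensions : Fin n → ℕ
      extensions x = length (filter (admissible? s used) (map (x ∷_) (allVecs n k)))
      rest : ℕ
      rest = ∏ℕ (λ (t : Fin k) → m (suc s + toℕ t))
      extensions-free : ∀ x → Free s used x → extensions x ≡ rest
      extensions-free x free = begin
          extensions x
        ≡⟨ length-filter-map (admissible? s used) (x ∷_) (allVecs n k) ⟩
          length (filter (admissible? s used ∘ (x ∷_)) (allVecs n k))
        ≡⟨ length-filter-≐ _ (admissible? (suc s) (x ∷ used)) (proj₂ , (free ,_)) (allVecs n k) ⟩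
          length (filter (admissible? (suc s) (x ∷ used)) (allVecs n k))
        ≡⟨ count-admissible k (free ∷ p) ⟩
          rest ∎
      extensions-blocked : ∀ x → ¬ Free s used x → extensions x ≡ 0
      extensions-blocked x blocked = trans (length-filter-map (admissible? s used) (x ∷_) (allVecs n k))
                                           (length-filter-none _ (All.universal (λ _ → blocked ∘ proj₁) (allVecs n k)))

  admissible⇒ : ∀ {k} s used (v : Vec (Fin n) k) → Admissible s used v →
    Injective _≡_ _≡_ (lookup v) × (∀ r → A (s + toℕ r) (lookup v r)) × (∀ r → lookup v r ∉ used)
  admissible⇒ s used []      _ = (λ { {()} }) , (λ ()) , (λ ())
  admissible⇒ s used (x ∷ v) ((Ax , x∉used) , adm) with admissible⇒ (suc s) (x ∷ used) v adm
  ... | inj , allowed , fresh = inj′ , allowed′ , fresh′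
    where
    inj′ : Injective _≡_ _≡_ (lookup (x ∷ v))
    inj′ {zero}  {zero}  _  = refl
    inj′ {zero}  {suc r} eq = ⊥-elim (fresh r (here (sym eq)))
    inj′ {suc r} {zero}  eq = ⊥-elim (fresh r (here eq))
    inj′ {suc r} {suc r′} eq = cong suc (inj eq)
    allowed′ : ∀ r → A (s + toℕ r) (lookup (x ∷ v) r)
    allowed′ zero    = subst (λ t → A t x) (sym (ℕP.+-identityʳ s)) Ax
    allowed′ (suc r) = subst (λ t → A t (lookup v r)) (sym (ℕP.+-suc s (toℕ r))) (allowed r)
    fresh′ : ∀ r → lookup (x ∷ v) r ∉ used
    fresh′ zero    = x∉used
    fresh′ (suc r) = fresh r ∘ there

  ⇒admissible : ∀ {k} s used (v : Vec (Fin n) k) → Injective _≡_ _≡_ (lookup v) →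
    (∀ r → A (s + toℕ r) (lookup v r)) → (∀ r → lookup v r ∉ used) → Admissible s used v
  ⇒admissible s used []      _   _       _     = tt
  ⇒admissible s used (x ∷ v) inj allowed fresh =
    (subst (λ t → A t x) (ℕP.+-identityʳ s) (allowed zero) , fresh zero) ,
    ⇒admissible (suc s) (x ∷ used) v (suc-injective ∘ inj)
      (λ r → subst (λ t → A t (lookup v r)) (ℕP.+-suc s (toℕ r)) (allowed (suc r)))
      (λ r → λ { (here eq) → 0≢suc (inj eq) ; (there r∈used) → fresh (suc r) r∈used })
    where
    0≢suc : ∀ {k} {r : Fin k} → ¬ Fin.suc r ≡ zero
    0≢suc ()

expectEntry≡0 : ∀ n (lam : Fin n → ℕ) (i j : Fin n) → lam (opposite i) < suc (toℕ j) → expectEntry n lam i j ≡ 0ℚ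
expectEntry≡0 n lam i j λ≤j = trans (cong (λ a → ratio a (length (RP n lam))) no-column)
                                    (ratio-0 (length (RP n lam)))
  where
  no-column : length (filter (λ v → lookup v i ≟ᶠ j) (RP n lam)) ≡ 0
  no-column = trans (length-filter-filter _ (inRP? n lam) (allVecs n n))
    (length-filter-none _ (All.universal (λ { v ((_ , bounded) , refl) → ℕP.<⇒≱ (bounded i) (ℕ.s≤s⁻¹ λ≤j) }) (allVecs n n)))

clamp : ∀ m → ℕ → Fin (suc m)
clamp zero    _       = zero
clamp (suc m) zero    = zero
clamp (suc m) (suc s) = suc (clamp m s)

clamp-toℕ : ∀ m (r : Fin (suc m)) → clamp m (toℕ r) ≡ r
clamp-toℕ zero    zero    = refl
clamp-toℕ (suc m) zero    = refl
clamp-toℕ (suc m) (suc r) = cong suc (clamp-toℕ m r)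

clamp-mono : ∀ m {s s′} → s ≤ s′ → toℕ (clamp m s) ≤ toℕ (clamp m s′)
clamp-mono zero    _                    = z≤n
clamp-mono (suc m) {zero}  _            = z≤n
clamp-mono (suc m) {suc s} {suc s′} s≤s′ = s≤s (clamp-mono m (ℕ.s≤s⁻¹ s≤s′))

m<n⇒n∸m≡1+[n∸1+m] : ∀ {m n} → m < n → n ∸ m ≡ suc (n ∸ suc m)
m<n⇒n∸m≡1+[n∸1+m] {zero}  {suc n} _       = refl
m<n⇒n∸m≡1+[n∸1+m] {suc m} {suc n} (s≤s m<n) = m<n⇒n∸m≡1+[n∸1+m] m<n

module Staircase (m : ℕ) (lam : Fin (suc m) → ℕ) (partition : IsPartition (suc m) lam)
  (lam₁≡n : ∀ (z : Fin (suc m)) → toℕ z ≡ 0 → lam z ≡ suc m)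
  (staircase : ∀ (k : Fin (suc m)) → lam k ≥ suc m ∸ toℕ k) where

  n : ℕ
  n = suc m

  -- Row s (0-based) of π ∈ RP(λ) may use exactly the columns below B s = λ_{n-s};
  -- clamping extends B beyond the last row.
  B : ℕ → ℕ
  B s = lam (opposite (clamp m s))

  B-toℕ : ∀ r → B (toℕ r) ≡ lam (opposite r)
  B-toℕ r = cong (lam ∘ opposite) (clamp-toℕ m r)

  B-mono : ∀ {s s′} → s ≤ s′ → B s ≤ B s′
  B-mono {s} {s′} s≤s′ = proj₁ partition _ _ opposite-anti
    where
    opposite-anti : toℕ (opposite (clamp m s′)) ≤ toℕ (opposite (clamp m s))
    opposite-anti rewrite opposite-prop (clamp m s) | opposite-prop (clamp m s′) = ℕP.∸-monoʳ-≤ m (clamp-mono m s≤s′)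

  B≤n : ∀ s → B s ≤ n
  B≤n s = subst (B s ≤_) (lam₁≡n zero refl) (proj₁ partition zero _ z≤n)

  s<B : ∀ {s} → s < n → s < B s
  s<B {s} s<n = subst₂ _<_ (toℕ-fromℕ< s<n) (sym B[s]) r<λ
    where
    r = Fin.fromℕ< s<n
    B[s] : B s ≡ lam (opposite r)
    B[s] = trans (cong B (sym (toℕ-fromℕ< s<n))) (B-toℕ r)
    r<λ : toℕ r < lam (opposite r)
    r<λ = subst (_≤ lam (opposite r)) n∸opposite (staircase (opposite r))
      where
      n∸opposite : n ∸ toℕ (opposite r) ≡ suc (toℕ r)
      n∸opposite rewrite opposite-prop r =
        trans (ℕP.+-∸-assoc 1 (ℕP.m∸n≤m m (toℕ r))) (cong suc (ℕP.m∸[m∸n]≡n (ℕ.s≤s⁻¹ (toℕ<n r))))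

  Allowed : ℕ → Pred (Fin n) 0ℓ
  Allowed s c = toℕ c < B s

  module Full = Sequences Allowed (below? ∘ B)

  RP-length : length (RP n lam) ≡ ∏ℕ (λ (t : Fin n) → B (toℕ t) ∸ toℕ t)
  RP-length = trans (length-filter-≐ (inRP? n lam) (Full.admissible? 0 []) (to , from) (allVecs n n))
                    (Full.count-admissible (λ s → B s ∸ s) #free≡ n Full.[])
    where
    #free≡ : ∀ {s used} → Full.Prefix s used → Full.#free s used ≡ B s ∸ s
    #free≡ {s} p = trans (Full.#free-⊆ p (Full.prefix-All p λ r<s c<B → ℕP.<-≤-trans c<B (B-mono (ℕP.<⇒≤ r<s))))
                           (cong (_∸ s) (count-below (B≤n s)))
    to : ∀ {v} → InRP n lam v → Full.Admissible 0 [] v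
    to {v} (perm , bounded) = Full.⇒admissible 0 [] v (perm _ _) (λ r → subst (toℕ (lookup v r) <_) (sym (B-toℕ r)) (bounded r)) (λ _ ())
    from : ∀ {v} → Full.Admissible 0 [] v → InRP n lam v
    from {v} adm with Full.admissible⇒ 0 [] v adm
    ... | inj , allowed , _ = (λ _ _ → inj) , (λ r → subst (toℕ (lookup v r) <_) (B-toℕ r) (allowed r))

  module Column (i j : Fin n) (j<Bi : toℕ j < B (toℕ i)) where

    -- Rows above i are kept off column j outright, so that j is still free when row i must take it.
    AllowedAt : ℕ → Pred (Fin n) 0ℓ
    AllowedAt s c = toℕ c < B s × (s ≡ toℕ i → c ≡ j) × (s < toℕ i → c ≢ j)

    allowedAt? : ∀ s → Decidable (AllowedAt s)
    allowedAt? s c = below? (B s) c ×-dec ((s ℕ.≟ toℕ i) →-dec (c ≟ᶠ j)) ×-dec ((s <? toℕ i) →-dec ¬? (c ≟ᶠ j))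

    module Pinned = Sequences AllowedAt allowedAt?

    choices : ℕ → ℕ
    choices s with ℕP.<-cmp s (toℕ i) | toℕ j <? B s
    ... | tri< _ _ _ | yes _ = B s ∸ suc s
    ... | tri< _ _ _ | no _  = B s ∸ s
    ... | tri≈ _ _ _ | _     = 1
    ... | tri> _ _ _ | _     = B s ∸ s

    used-below : ∀ {s used} → Pinned.Prefix s used → All (λ c → toℕ c < B s) used
    used-below p = Pinned.prefix-All p λ r<s (c<B , _) → ℕP.<-≤-trans c<B (B-mono (ℕP.<⇒≤ r<s))

    used-avoid : ∀ {s used} → Pinned.Prefix s used → s ≤ toℕ i → All (_≢ j) used
    used-avoid p s≤i = Pinned.prefix-All p λ r<s (_ , _ , c≢j) → c≢j (ℕP.<-≤-trans r<s s≤i)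

    #free-reaching : ∀ {s used} → s < toℕ i → toℕ j < B s → Pinned.Prefix s used → Pinned.#free s used ≡ B s ∸ suc s
    #free-reaching {s} {used} s<i j<B p = begin
      Pinned.#free s used ≡⟨ Pinned.#free-⊆ p (All.zipWith (λ (c<B , c≢j) → allowed c<B c≢j)
                                                      (used-below p , used-avoid p (ℕP.<⇒≤ s<i))) ⟩
      Pinned.#allowed s ∸ s    ≡⟨ cong (_∸ s) (length-filter-≐ (allowedAt? s) (below? (B s) ∩? ∁? (_≟ᶠ j)) allowed≐ (allFin n)) ⟩
      length (filter (below? (B s) ∩? ∁? (_≟ᶠ j)) (allFin n)) ∸ s
                          ≡⟨ cong (_∸ s) (count-below-≢ j j<B (B≤n s)) ⟩
      B s ∸ 1 ∸ s         ≡⟨ ℕP.∸-+-assoc (B s) 1 s ⟩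
      B s ∸ suc s         ∎
      where
      open ≡-Reasoning
      allowed : ∀ {c} → toℕ c < B s → c ≢ j → AllowedAt s c
      allowed c<B c≢j = c<B , ⊥-elim ∘ ℕP.<⇒≢ s<i , λ _ → c≢j
      allowed≐ : AllowedAt s ≐ (λ c → toℕ c < B s × c ≢ j)
      allowed≐ = (λ (c<B , _ , c≢j) → c<B , c≢j s<i) , λ (c<B , c≢j) → allowed c<B c≢j

    #free-unconstrained : ∀ {s used} → s ≢ toℕ i → (s < toℕ i → B s ≤ toℕ j) → Pinned.Prefix s used →
                          Pinned.#free s used ≡ B s ∸ s
    #free-unconstrained {s} s≢i B≤j p = trans (Pinned.#free-⊆ p (All.map allowed (used-below p)))
      (cong (_∸ s) (trans (length-filter-≐ (allowedAt? s) (below? (B s)) (proj₁ , allowed) (allFin n)) (count-below (B≤n s))))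
      where
      allowed : ∀ {c} → toℕ c < B s → AllowedAt s c
      allowed c<B = c<B , ⊥-elim ∘ s≢i , λ { s<i refl → ℕP.<⇒≱ c<B (B≤j s<i) }

    #free-pinned : ∀ {used} → Pinned.Prefix (toℕ i) used → Pinned.#free (toℕ i) used ≡ 1
    #free-pinned p = trans (Pinned.#free-disjoint p (All.map (λ c≢j → c≢j ∘ only-j) (used-avoid p ℕP.≤-refl)))
      (trans (length-filter-≐ (allowedAt? (toℕ i)) (_≟ᶠ j) (only-j , λ { refl → j-allowed }) (allFin n)) (count-≡ n j))
      where
      only-j : ∀ {c} → AllowedAt (toℕ i) c → c ≡ j
      only-j (_ , c≡j , _) = c≡j refl
      j-allowed : AllowedAt (toℕ i) j
      j-allowed = j<Bi , (λ _ → refl) , λ i<i _ → ℕP.<-irrefl refl i<i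

    #free≡choices : ∀ {s used} → Pinned.Prefix s used → Pinned.#free s used ≡ choices s
    #free≡choices {s} p with ℕP.<-cmp s (toℕ i) | toℕ j <? B s
    ... | tri< s<i _ _   | yes j<B = #free-reaching s<i j<B p
    ... | tri< s<i s≢i _ | no j≮B  = #free-unconstrained s≢i (λ _ → ℕP.≮⇒≥ j≮B) p
    ... | tri≈ _ refl _  | _       = #free-pinned p
    ... | tri> _ s≢i i<s | _       = #free-unconstrained s≢i (⊥-elim ∘ ℕP.<⇒≯ i<s) p

    column-length : length (filter (λ v → lookup v i ≟ᶠ j) (RP n lam)) ≡ ∏ℕ (λ (t : Fin n) → choices (toℕ t))
    column-length = begin
        length (filter (λ v → lookup v i ≟ᶠ j) (RP n lam))
      ≡⟨ length-filter-filter _ (inRP? n lam) (allVecs n n) ⟩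
        length (filter (inRP? n lam ∩? λ v → lookup v i ≟ᶠ j) (allVecs n n))
      ≡⟨ length-filter-≐ _ (Pinned.admissible? 0 []) (to , from) (allVecs n n) ⟩
        length (filter (Pinned.admissible? 0 []) (allVecs n n))
      ≡⟨ Pinned.count-admissible choices #free≡choices n Pinned.[] ⟩
        ∏ℕ (λ (t : Fin n) → choices (toℕ t)) ∎
      where
      open ≡-Reasoning
      to : ∀ {v} → InRP n lam v × lookup v i ≡ j → Pinned.Admissible 0 [] v
      to {v} ((perm , bounded) , vᵢ≡j) = Pinned.⇒admissible 0 [] v (perm _ _) allowed (λ _ ())
        where
        allowed : ∀ r → AllowedAt (toℕ r) (lookup v r)
        allowed r = subst (toℕ (lookup v r) <_) (sym (B-toℕ r)) (bounded r)
                  , (λ r≡i → trans (cong (lookup v) (toℕ-injective r≡i)) vᵢ≡j)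
                  , (λ r<i vᵣ≡j → ℕP.<⇒≢ r<i (cong toℕ (perm r i (trans vᵣ≡j (sym vᵢ≡j)))))
      from : ∀ {v} → Pinned.Admissible 0 [] v → InRP n lam v × lookup v i ≡ j
      from {v} adm with Pinned.admissible⇒ 0 [] v adm
      ... | inj , allowed , _ = ((λ _ _ → inj) , λ r → subst (toℕ (lookup v r) <_) (B-toℕ r) (proj₁ (allowed r)))
                              , proj₁ (proj₂ (allowed i)) refl

    module _ (i′ : Fin n) (j<Bi′ : toℕ j < B (toℕ i′)) (B≤j : ∀ (k : Fin n) → toℕ k < toℕ i′ → B (toℕ k) ≤ toℕ j) where

      Window : Pred (Fin n) 0ℓ
      Window t = toℕ i′ ≤ toℕ t × toℕ t < toℕ i

      window? : Decidable Window
      window? t = (toℕ i′ ≤? toℕ t) ×-dec (toℕ t <? toℕ i)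

      windowFactor : Fin n → ℚ
      windowFactor t = if does (window? t) then factor n lam t else 1ℚ

      lastFactorAt : Fin n → ℚ
      lastFactorAt t = if does (t ≟ᶠ i) then lastFactor n lam i else 1ℚ

      windowFactor-product : prodFactors n lam i′ i ≡ ∏ℚ windowFactor
      windowFactor-product = trans (foldr-*-filter window? (factor n lam) (allFin n)) (foldr-*-allFin windowFactor)

      lastFactorAt-product : ∏ℚ lastFactorAt ≡ lastFactor n lam i
      lastFactorAt-product = trans (∏ℚ-single lastFactorAt i λ t t≢i → cong (if_then lastFactor n lam i else 1ℚ) (dec-false (t ≟ᶠ i) t≢i))
                                   (cong (if_then lastFactor n lam i else 1ℚ) (dec-true (i ≟ᶠ i) refl))

      window-row : ∀ {t} → Window t → t ≢ i → windowFactor t * lastFactorAt t ≡ factor n lam t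
      window-row {t} w t≢i = trans (cong₂ _*_ (cong (if_then factor n lam t else 1ℚ) (dec-true (window? t) w))
                                              (cong (if_then lastFactor n lam i else 1ℚ) (dec-false (t ≟ᶠ i) t≢i)))
                                   (ℚP.*-identityʳ (factor n lam t))

      other-row : ∀ {t} → ¬ Window t → t ≢ i → windowFactor t * lastFactorAt t ≡ 1ℚ
      other-row {t} ¬w t≢i = cong₂ _*_ (cong (if_then factor n lam t else 1ℚ) (dec-false (window? t) ¬w))
                                       (cong (if_then lastFactor n lam i else 1ℚ) (dec-false (t ≟ᶠ i) t≢i))

      last-row : windowFactor i * lastFactorAt i ≡ lastFactor n lam i
      last-row = trans (cong₂ _*_ (cong (if_then factor n lam i else 1ℚ) (dec-false (window? i) λ (_ , i<i) → ℕP.<-irrefl refl i<i))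
                                  (cong (if_then lastFactor n lam i else 1ℚ) (dec-true (i ≟ᶠ i) refl)))
                       (ℚP.*-identityˡ (lastFactor n lam i))

      rows-remaining : ∀ t → B (toℕ t) ∸ toℕ t ≡ suc (B (toℕ t) ∸ suc (toℕ t))
      rows-remaining t = m<n⇒n∸m≡1+[n∸1+m] (s<B (toℕ<n t))

      ratio-remaining : ∀ t → ratio (B (toℕ t) ∸ toℕ t) (B (toℕ t) ∸ toℕ t) ≡ 1ℚ
      ratio-remaining t = trans (cong₂ ratio (rows-remaining t) (rows-remaining t)) (ratio-n/n (B (toℕ t) ∸ suc (toℕ t)))

      row-ratio : ∀ t → ratio (choices (toℕ t)) (B (toℕ t) ∸ toℕ t) ≡ windowFactor t * lastFactorAt t
      row-ratio t with ℕP.<-cmp (toℕ t) (toℕ i) | toℕ j <? B (toℕ t)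
      ... | tri< t<i _ _ | yes j<B = begin
          ratio (B (toℕ t) ∸ suc (toℕ t)) (B (toℕ t) ∸ toℕ t)
        ≡⟨ cong (ratio _) (rows-remaining t) ⟩
          ratio (B (toℕ t) ∸ suc (toℕ t)) (suc (B (toℕ t) ∸ suc (toℕ t)))
        ≡⟨ cong (λ b → ratio (b ∸ suc (toℕ t)) (suc (b ∸ suc (toℕ t)))) (B-toℕ t) ⟩
          factor n lam t
        ≡⟨ window-row (i′≤t , t<i) (ℕP.<⇒≢ t<i ∘ cong toℕ) ⟨
          windowFactor t * lastFactorAt t ∎
        where
        open ≡-Reasoning
        i′≤t : toℕ i′ ≤ toℕ t
        i′≤t = ℕP.≮⇒≥ λ t<i′ → ℕP.<⇒≱ j<B (B≤j t t<i′)
      ... | tri< t<i _ _ | no j≮B =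
        trans (ratio-remaining t)
              (sym (other-row (λ (i′≤t , _) → j≮B (ℕP.<-≤-trans j<Bi′ (B-mono i′≤t))) (ℕP.<⇒≢ t<i ∘ cong toℕ)))
      ... | tri> _ t≢i i<t | _ =
        trans (ratio-remaining t) (sym (other-row (λ (_ , t<i) → ℕP.<⇒≯ t<i i<t) (t≢i ∘ cong toℕ)))
      ... | tri≈ _ t≡i _ | _ with toℕ-injective t≡i
      ...   | refl = begin
        ratio 1 (B (toℕ i) ∸ toℕ i)                    ≡⟨ cong (ratio 1) (rows-remaining i) ⟩
        ratio 1 (suc (B (toℕ i) ∸ suc (toℕ i)))        ≡⟨ cong (λ b → ratio 1 (suc (b ∸ suc (toℕ i)))) (B-toℕ i) ⟩
        lastFactor n lam i                             ≡⟨ last-row ⟨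
        windowFactor i * lastFactorAt i                ∎
        where open ≡-Reasoning

      expectEntry-factorised : expectEntry n lam i j ≡ prodFactors n lam i′ i * lastFactor n lam i
      expectEntry-factorised = begin
          expectEntry n lam i j
        ≡⟨ cong₂ ratio column-length RP-length ⟩
          ratio (∏ℕ (λ (t : Fin n) → choices (toℕ t))) (∏ℕ (λ (t : Fin n) → B (toℕ t) ∸ toℕ t))
        ≡⟨ ratio-∏ (choices ∘ toℕ) (λ t → B (toℕ t) ∸ toℕ t) (λ t → ℕP.m<n⇒0<n∸m (s<B (toℕ<n t))) ⟩
          ∏ℚ (λ (t : Fin n) → ratio (choices (toℕ t)) (B (toℕ t) ∸ toℕ t))
        ≡⟨ ∏ℚ-cong row-ratio ⟩
          ∏ℚ (λ (t : Fin n) → windowFactor t * lastFactorAt t)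
        ≡⟨ ∏ℚ-distrib-* windowFactor lastFactorAt ⟩
          ∏ℚ windowFactor * ∏ℚ lastFactorAt
        ≡⟨ cong₂ _*_ (sym windowFactor-product) lastFactorAt-product ⟩
          prodFactors n lam i′ i * lastFactor n lam i ∎
        where open ≡-Reasoning

  expectEntry-formula : ∀ i j i′ → toℕ j < lam (opposite i) → toℕ j < lam (opposite i′) →
    (∀ (k : Fin n) → toℕ k < toℕ i′ → lam (opposite k) < suc (toℕ j)) →
    expectEntry n lam i j ≡ prodFactors n lam i′ i * lastFactor n lam i
  expectEntry-formula i j i′ j<λi j<λi′ before-i′ =
    Column.expectEntry-factorised i j (toB i j<λi) i′ (toB i′ j<λi′)
      (λ k k<i′ → subst (_≤ toℕ j) (sym (B-toℕ k)) (ℕ.s≤s⁻¹ (before-i′ k k<i′)))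
    where
    toB : ∀ r → toℕ j < lam (opposite r) → toℕ j < B (toℕ r)
    toB r = subst (toℕ j <_) (sym (B-toℕ r))

proposition5p1 : (n : ℕ) → .{{_ : NonZero n}} → (lam : Fin n → ℕ)
    → IsPartition n lam
    → (lam1 : ∀ (z : Fin n) → toℕ z ≡ 0 → lam z ≡ n)
    → (∀ (k : Fin n) → lam k ≥ n ∸ toℕ k)
    → (i j : Fin n)
    → ((lam (opposite i) < suc (toℕ j) → expectEntry n lam i j ≡ 0ℚ)
      × (∀ (i' : Fin n) → lam (opposite i) ≥ suc (toℕ j)
          → lam (opposite i') ≥ suc (toℕ j)
          → (∀ (k : Fin n) → toℕ k < toℕ i' → lam (opposite k) < suc (toℕ j))
          → expectEntry n lam i j ≡ prodFactors n lam i' i * lastFactor n lam i))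
proposition5p1 zero    lam _         _     _         () _
proposition5p1 (suc m) lam partition lam₁≡n staircase i j =
  expectEntry≡0 (suc m) lam i j , expectEntry-formula i j
  where open Staircase m lam partition lam₁≡n staircase
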